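{- There exists a deterministic algorithm for Graph Reconstruction that executes $O(\Delta^3\log n)$ non-adaptive Maximal Independent Set queries and correctly reconstructs every $n$-vertex input graph with maximum degree $\Delta$.
   Context: Graph Reconstruction problem: an algorithm initially knows only the vertex set $V$ ($|V|=n$) of an unknown simple undirected input graph $G=(V,E)$ and must determine $E$. Access to $G$ is only via a Maximal Independent Set oracle: in each query the algorithm submits a subset $U\subseteq V$, and the oracle returns an arbitrary (possibly adversarially chosen) maximal independent set of the induced subgraph $G[U]$. Queries are non-adaptive if they do not depend on the answers to other queries. -}

module Defs where

open import Data.Nat using (ℕ; _≤_)
open import Data.Bool using (Bool; true; false)
open import Data.Fin using (Fin)
open import Data.Fin.Subset using (Subset; _∈_; _∉_; _⊆_; ∣_∣)
open import Data.Vec using (tabulate)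
open import Data.Product using (Σ; _×_)
open import Relation.Binary.PropositionalEquality using (_≡_)

record Graph (n : ℕ) : Set where
  field
    adj     : Fin n → Fin n → Bool
    adj-sym : ∀ u v → adj u v ≡ adj v u
    irrefl  : ∀ v → adj v v ≡ false
open Graph public

degree : ∀ {n} → Graph n → Fin n → ℕ
degree G v = ∣ tabulate (adj G v) ∣

MaxDegree≤ : ∀ {n} → Graph n → ℕ → Set
MaxDegree≤ G Δ = ∀ v → degree G v ≤ Δ

IsIndependentIn : ∀ {n} → Graph n → Subset n → Subset n → Set
IsIndependentIn G U I = I ⊆ U × (∀ {u v} → u ∈ I → v ∈ I → adj G u v ≡ false)

IsMaximalIndependentIn : ∀ {n} → Graph n → Subset n → Subset n → Set
IsMaximalIndependentIn G U I =
  IsIndependentIn G U I ×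
  (∀ {v} → v ∈ U → v ∉ I → Σ (Fin _) (λ u → u ∈ I × adj G u v ≡ true))

-- Query, for every hash function h : V → [q] in a fixed family and every pair of colours α, β,
-- the set h⁻¹{α, β}; decide that u and v are adjacent iff no answer contains both. Adjacent
-- vertices never lie in a common independent set. If u and v are non-adjacent and h separates
-- each of them from all of their at most 2Δ neighbours, then u and v are isolated in
-- h⁻¹{h u, h v} and therefore belong to every maximal independent set of it.
--
-- With q = 8Δ, a uniformly random h (a vector in Vec (Fin q) n) fails to separate a fixed
-- u, v and list s of 2Δ vertices with probability at most 4Δ/q = 1/2, by a union bound over
-- single collisions. Greedily picking a hash function that handles at least half of the
-- still unhandled requirements u ∷ v ∷ s, of which there are n^(2Δ+2) < 2^(1 + (2Δ+2)⌈log₂ n⌉),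
-- yields a family of 1 + (2Δ+2)⌈log₂ n⌉ functions, hence (1 + (2Δ+2)⌈log₂ n⌉)(8Δ)² = O(Δ³ log n)
-- non-adaptive queries.

module Submission where

open import Defs
open import Data.Bool using (Bool; true; false; if_then_else_)
open import Data.Fin using (Fin; zero; suc; _≟_; combine; remQuot)
open import Data.Fin.Properties using (all?; remQuot-combine)
open import Data.Fin.Subset using (Subset; _∈_; _∉_; ⁅_⁆; _∪_; ∣_∣; inside; outside)
open import Data.Fin.Subset.Properties using (_∈?_; x∈⁅x⁆; x∈⁅y⁆⇒x≡y; x∈p∪q⁺; x∈p∪q⁻)
import Data.Nat as ℕ
open import Data.Nat using (ℕ; zero; suc; _+_; _*_; _^_; _≤_; _<_; z≤n; s≤s; _≤?_; ⌊_/2⌋; ⌈_/2⌉)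
open import Data.Nat.Induction using (<-wellFounded)
open import Data.Nat.Logarithm using (⌈log₂_⌉)
open import Data.Nat.Logarithm.Core using (⌈log2⌉)
open import Data.Nat.Properties hiding (_≟_)
open import Algebra.Properties.Semiring.Sum +-*-semiring
  using (sum-syntax; sum-cong-≗; ∑-distrib-+; ∑-comm; *-distribˡ-sum)
open import Data.Nat.Tactic.RingSolver using (solve-∀)
open import Data.Product using (Σ; ∃; _×_; _,_; proj₁; proj₂; uncurry)
open import Data.Sum using (inj₁; inj₂)
open import Data.Unit using (tt)
open import Data.Vec using (Vec; []; _∷_; here; there; lookup; map; tabulate; _++_; padRight)
open import Data.Vec.Properties using (lookup-map; lookup∘tabulate; []=⇒lookup; lookup⇒[]=)
open import Data.Vec.Membership.Propositional using () renaming (_∈_ to _∈ᵛ_)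
open import Data.Vec.Membership.Propositional.Properties using (∈-map⁺; ∈-++⁺ˡ; ∈-++⁺ʳ)
import Data.Vec.Relation.Unary.Any as Any
open import Data.Vec.Relation.Unary.Any.Properties using (lookup-index)
open import Function using (_∘_; case_of_)
open import Induction.WellFounded using (Acc; acc)
open import Relation.Binary.PropositionalEquality
open import Relation.Nullary using (Dec; does; yes; no; ¬_; contradiction; ¬?; _×-dec_)
open import Relation.Nullary.Decidable using (dec-true; dec-false)

𝟙 : ∀ {a} {A : Set a} → Dec A → ℕ
𝟙 a? = if does a? then 1 else 0

𝟙-yes : ∀ {a} {A : Set a} (a? : Dec A) → A → 𝟙 a? ≡ 1
𝟙-yes a? a rewrite dec-true a? a = refl

𝟙-split : ∀ {a b} {A : Set a} {B : Set b} (a? : Dec A) (b? : Dec B) →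
          𝟙 a? ≡ 𝟙 (a? ×-dec b?) + 𝟙 (a? ×-dec ¬? b?)
𝟙-split a? b? with does a? | does b?
... | true  | true  = refl
... | true  | false = refl
... | false | _     = refl

𝟙≡0⇒¬ : ∀ {a} {A : Set a} (a? : Dec A) → 𝟙 a? ≡ 0 → ¬ A
𝟙≡0⇒¬ a? 𝟙≡0 a with () ← trans (sym (𝟙-yes a? a)) 𝟙≡0

𝟙+𝟙¬≡1 : ∀ {a} {A : Set a} (a? : Dec A) → 𝟙 a? + 𝟙 (¬? a?) ≡ 1
𝟙+𝟙¬≡1 a? with does a?
... | true  = refl
... | false = refl

𝟙-nonzero≤ : ∀ c → 𝟙 (¬? (c ℕ.≟ 0)) ≤ c
𝟙-nonzero≤ zero    = z≤n
𝟙-nonzero≤ (suc c) = s≤s z≤n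

𝟙-≟-sym : ∀ {q} (a b : Fin q) → 𝟙 (a ≟ b) ≡ 𝟙 (b ≟ a)
𝟙-≟-sym a b with a ≟ b | b ≟ a
... | yes _   | yes _   = refl
... | no _    | no _    = refl
... | yes a≡b | no b≢a  = contradiction (sym a≡b) b≢a
... | no a≢b  | yes b≡a = contradiction (sym b≡a) a≢b

∑-const : ∀ q c → ∑[ a < q ] c ≡ q * c
∑-const zero    c = refl
∑-const (suc q) c = cong (c +_) (∑-const q c)

∑-mono-≤ : ∀ {q} {f g : Fin q → ℕ} → (∀ a → f a ≤ g a) → ∑[ a < q ] f a ≤ ∑[ a < q ] g a
∑-mono-≤ {zero}  f≤g = z≤n
∑-mono-≤ {suc q} f≤g = +-mono-≤ (f≤g zero) (∑-mono-≤ (f≤g ∘ suc))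

≤-∑ : ∀ {q} (f : Fin q → ℕ) a → f a ≤ ∑[ b < q ] f b
≤-∑ f zero    = m≤m+n _ _
≤-∑ f (suc a) = m≤n⇒m≤o+n (f zero) (≤-∑ (f ∘ suc) a)

∑-δ : ∀ {q} (a : Fin q) → ∑[ b < q ] 𝟙 (a ≟ b) ≡ 1
∑-δ {suc q} zero    = cong suc (trans (∑-const q 0) (*-zeroʳ q))
∑-δ {suc q} (suc a) = ∑-δ a

∑-averaging : ∀ {q} (f : Fin (suc q) → ℕ) {X} → suc q * X ≤ ∑[ a < suc q ] f a → ∃ λ a → X ≤ f a
∑-averaging f {X} le with X ≤? f zero
... | yes X≤f₀ = zero , X≤f₀
∑-averaging {zero}  f {X} le | no X≰f₀ =
  contradiction (subst₂ _≤_ (*-identityˡ X) (+-identityʳ (f zero)) le) X≰f₀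
∑-averaging {suc q} f {X} le | no X≰f₀ =
  let a , X≤fa = ∑-averaging (f ∘ suc) rest in suc a , X≤fa
  where
  rest : suc q * X ≤ ∑[ a < suc q ] f (suc a)
  rest = +-cancelˡ-≤ X _ _ (≤-trans le (+-monoˡ-≤ _ (≰⇒≥ X≰f₀)))

∑ᵛ : ∀ {q n} → (Vec (Fin q) n → ℕ) → ℕ
∑ᵛ {n = zero}      f = f []
∑ᵛ {q} {n = suc n} f = ∑[ a < q ] ∑ᵛ (λ t → f (a ∷ t))

∑ᵛ-cong : ∀ {q n} {f g : Vec (Fin q) n → ℕ} → (∀ h → f h ≡ g h) → ∑ᵛ f ≡ ∑ᵛ g
∑ᵛ-cong {n = zero}  f≗g = f≗g []
∑ᵛ-cong {n = suc n} f≗g = sum-cong-≗ λ a → ∑ᵛ-cong λ t → f≗g (a ∷ t)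

∑ᵛ-mono-≤ : ∀ {q n} {f g : Vec (Fin q) n → ℕ} → (∀ h → f h ≤ g h) → ∑ᵛ f ≤ ∑ᵛ g
∑ᵛ-mono-≤ {n = zero}  f≤g = f≤g []
∑ᵛ-mono-≤ {n = suc n} f≤g = ∑-mono-≤ λ a → ∑ᵛ-mono-≤ λ t → f≤g (a ∷ t)

≤-∑ᵛ : ∀ {q n} (f : Vec (Fin q) n → ℕ) h → f h ≤ ∑ᵛ f
≤-∑ᵛ f []      = ≤-refl
≤-∑ᵛ f (a ∷ h) = ≤-trans (≤-∑ᵛ (λ t → f (a ∷ t)) h) (≤-∑ (λ b → ∑ᵛ λ t → f (b ∷ t)) a)

∑ᵛ-distrib-+ : ∀ {q n} (f g : Vec (Fin q) n → ℕ) → ∑ᵛ (λ h → f h + g h) ≡ ∑ᵛ f + ∑ᵛ g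
∑ᵛ-distrib-+ {n = zero}  f g = refl
∑ᵛ-distrib-+ {n = suc n} f g =
  trans (sum-cong-≗ λ a → ∑ᵛ-distrib-+ (λ t → f (a ∷ t)) (λ t → g (a ∷ t)))
        (∑-distrib-+ (λ a → ∑ᵛ λ t → f (a ∷ t)) (λ a → ∑ᵛ λ t → g (a ∷ t)))

*-distribˡ-∑ᵛ : ∀ {q n} c (f : Vec (Fin q) n → ℕ) → c * ∑ᵛ f ≡ ∑ᵛ (λ h → c * f h)
*-distribˡ-∑ᵛ {n = zero}  c f = refl
*-distribˡ-∑ᵛ {n = suc n} c f =
  trans (*-distribˡ-sum c (λ a → ∑ᵛ λ t → f (a ∷ t)))
        (sum-cong-≗ λ a → *-distribˡ-∑ᵛ c (λ t → f (a ∷ t)))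

∑ᵛ-const : ∀ q n c → ∑ᵛ {q} {n} (λ _ → c) ≡ q ^ n * c
∑ᵛ-const q zero    c = sym (+-identityʳ c)
∑ᵛ-const q (suc n) c = begin
  ∑[ a < q ] ∑ᵛ {q} {n} (λ _ → c) ≡⟨ sum-cong-≗ {q} (λ _ → ∑ᵛ-const q n c) ⟩
  ∑[ a < q ] (q ^ n * c)          ≡⟨ ∑-const q (q ^ n * c) ⟩
  q * (q ^ n * c)                 ≡⟨ *-assoc q (q ^ n) c ⟨
  q ^ suc n * c                   ∎
  where open ≡-Reasoning

∑ᵛ-zero : ∀ q n → ∑ᵛ {q} {n} (λ _ → 0) ≡ 0
∑ᵛ-zero q n = trans (∑ᵛ-const q n 0) (*-zeroʳ (q ^ n))

∑ᵛ-∑-comm : ∀ {q n p} (f : Vec (Fin q) n → Fin p → ℕ) →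
            ∑ᵛ (λ h → ∑[ i < p ] f h i) ≡ ∑[ i < p ] ∑ᵛ (λ h → f h i)
∑ᵛ-∑-comm {n = zero}  f = refl
∑ᵛ-∑-comm {n = suc n} f =
  trans (sum-cong-≗ λ a → ∑ᵛ-∑-comm (λ t → f (a ∷ t))) (∑-comm λ a i → ∑ᵛ λ t → f (a ∷ t) i)

∑ᵛ-comm : ∀ {q n p k} (f : Vec (Fin q) n → Vec (Fin p) k → ℕ) →
          ∑ᵛ (λ h → ∑ᵛ (f h)) ≡ ∑ᵛ (λ r → ∑ᵛ λ h → f h r)
∑ᵛ-comm {n = zero}  f = refl
∑ᵛ-comm {n = suc n} f =
  trans (sum-cong-≗ λ a → ∑ᵛ-comm (λ t → f (a ∷ t)))
        (sym (∑ᵛ-∑-comm λ r a → ∑ᵛ λ t → f (a ∷ t) r))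

∑ᵛ-averaging : ∀ {q n} (f : Vec (Fin (suc q)) n → ℕ) {X} →
               suc q ^ n * X ≤ ∑ᵛ f → ∃ λ h → X ≤ f h
∑ᵛ-averaging {n = zero}  f {X} le = [] , subst (_≤ f []) (+-identityʳ X) le
∑ᵛ-averaging {q} {suc n} f {X} le =
  let a , le′ = ∑-averaging (λ a → ∑ᵛ λ t → f (a ∷ t))
                  (subst (_≤ ∑ᵛ f) (*-assoc (suc q) (suc q ^ n) X) le)
      t , X≤f = ∑ᵛ-averaging (λ t → f (a ∷ t)) le′
  in a ∷ t , X≤f

∑ᵛ-marginal : ∀ {q n} (w : Fin n) (g : Fin q → ℕ) →
              q * ∑ᵛ (λ h → g (lookup h w)) ≡ q ^ n * ∑[ a < q ] g a
∑ᵛ-marginal {q} {suc n} zero g = begin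
  q * ∑[ a < q ] ∑ᵛ {q} {n} (λ _ → g a) ≡⟨ cong (q *_) (sum-cong-≗ {q} λ a → ∑ᵛ-const q n (g a)) ⟩
  q * ∑[ a < q ] (q ^ n * g a)          ≡⟨ cong (q *_) (*-distribˡ-sum (q ^ n) g) ⟨
  q * (q ^ n * ∑[ a < q ] g a)          ≡⟨ *-assoc q (q ^ n) _ ⟨
  q ^ suc n * ∑[ a < q ] g a            ∎
  where open ≡-Reasoning
∑ᵛ-marginal {q} {suc n} (suc w) g = begin
  q * ∑[ a < q ] ∑ᵛ (λ t → g (lookup t w)) ≡⟨ cong (q *_) (∑-const q _) ⟩
  q * (q * ∑ᵛ (λ t → g (lookup t w)))      ≡⟨ cong (q *_) (∑ᵛ-marginal w g) ⟩
  q * (q ^ n * ∑[ a < q ] g a)             ≡⟨ *-assoc q (q ^ n) _ ⟨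
  q ^ suc n * ∑[ a < q ] g a               ∎
  where open ≡-Reasoning

∑ᵛ-collision : ∀ {q n} {w u : Fin n} → w ≢ u →
               q * ∑ᵛ {q} (λ h → 𝟙 (lookup h w ≟ lookup h u)) ≡ q ^ n
∑ᵛ-collision {q} {suc n} {zero} {zero} w≢u = contradiction refl w≢u
∑ᵛ-collision {q} {suc n} {zero} {suc u} _ = begin
  q * ∑[ a < q ] ∑ᵛ {q} (λ t → 𝟙 (a ≟ lookup t u))
    ≡⟨ *-distribˡ-sum {q} q (λ a → ∑ᵛ λ t → 𝟙 (a ≟ lookup t u)) ⟩
  ∑[ a < q ] (q * ∑ᵛ (λ t → 𝟙 (a ≟ lookup t u)))
    ≡⟨ sum-cong-≗ {q} (λ a → ∑ᵛ-marginal u (λ b → 𝟙 (a ≟ b))) ⟩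
  ∑[ a < q ] (q ^ n * ∑[ b < q ] 𝟙 (a ≟ b))  ≡⟨ sum-cong-≗ {q} (λ a → cong (q ^ n *_) (∑-δ a)) ⟩
  ∑[ a < q ] (q ^ n * 1)                      ≡⟨ ∑-const q (q ^ n * 1) ⟩
  q * (q ^ n * 1)                             ≡⟨ cong (q *_) (*-identityʳ (q ^ n)) ⟩
  q ^ suc n                                   ∎
  where open ≡-Reasoning
∑ᵛ-collision {q} {suc n} {suc w} {zero} _ =
  trans (cong (q *_) (∑ᵛ-cong {q} λ h → 𝟙-≟-sym (lookup h (suc w)) (lookup h zero)))
        (∑ᵛ-collision {q} {w = zero} {u = suc w} λ ())
∑ᵛ-collision {q} {suc n} {suc w} {suc u} sw≢su = begin
  q * ∑[ a < q ] ∑ᵛ (λ t → 𝟙 (lookup t w ≟ lookup t u))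
    ≡⟨ cong (q *_) (∑-const q _) ⟩
  q * (q * ∑ᵛ (λ t → 𝟙 (lookup t w ≟ lookup t u)))
    ≡⟨ cong (q *_) (∑ᵛ-collision (sw≢su ∘ cong suc)) ⟩
  q ^ suc n                                             ∎
  where open ≡-Reasoning

∑ᵛ-half-zero : ∀ {q n} (f : Vec (Fin q) n → ℕ) →
               2 * ∑ᵛ f ≤ q ^ n → q ^ n ≤ 2 * ∑ᵛ (λ h → 𝟙 (f h ℕ.≟ 0))
∑ᵛ-half-zero {q} {n} f 2∑f≤ = +-cancelʳ-≤ (2 * B) (q ^ n) (2 * Z) (begin
  q ^ n + 2 * B     ≤⟨ +-monoʳ-≤ (q ^ n) (≤-trans (*-monoʳ-≤ 2 B≤∑f) 2∑f≤) ⟩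
  q ^ n + q ^ n     ≡⟨ cong (q ^ n +_) (+-identityʳ (q ^ n)) ⟨
  2 * q ^ n         ≡⟨ cong (2 *_) Z+B≡qⁿ ⟨
  2 * (Z + B)       ≡⟨ *-distribˡ-+ 2 Z B ⟩
  2 * Z + 2 * B     ∎)
  where
  open ≤-Reasoning
  Z = ∑ᵛ λ h → 𝟙 (f h ℕ.≟ 0)
  B = ∑ᵛ λ h → 𝟙 (¬? (f h ℕ.≟ 0))
  B≤∑f : B ≤ ∑ᵛ f
  B≤∑f = ∑ᵛ-mono-≤ λ h → 𝟙-nonzero≤ (f h)
  Z+B≡qⁿ : Z + B ≡ q ^ n
  Z+B≡qⁿ = begin-equality
    Z + B                    ≡⟨ ∑ᵛ-distrib-+ (λ h → 𝟙 (f h ℕ.≟ 0)) (λ h → 𝟙 (¬? (f h ℕ.≟ 0))) ⟨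
    ∑ᵛ (λ h → 𝟙 (f h ℕ.≟ 0) + 𝟙 (¬? (f h ℕ.≟ 0)))
                             ≡⟨ ∑ᵛ-cong (λ h → 𝟙+𝟙¬≡1 (f h ℕ.≟ 0)) ⟩
    ∑ᵛ {q} {n} (λ _ → 1)     ≡⟨ ∑ᵛ-const q n 1 ⟩
    q ^ n * 1                ≡⟨ *-identityʳ (q ^ n) ⟩
    q ^ n                    ∎

-- A vertex never collides with itself: the neighbour lists of u and v below are padded with u and v.
Collides : ∀ {q n} → Vec (Fin q) n → Fin n → Fin n → Set
Collides h w u = w ≢ u × lookup h w ≡ lookup h u

collides? : ∀ {q n} (h : Vec (Fin q) n) w u → Dec (Collides h w u)
collides? h w u = ¬? (w ≟ u) ×-dec (lookup h w ≟ lookup h u)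

∑ᵛ-collides : ∀ {q n} (w u : Fin n) → q * ∑ᵛ {q} (λ h → 𝟙 (collides? h w u)) ≤ q ^ n
∑ᵛ-collides {q} {n} w u with w ≟ u
... | yes _   = subst (_≤ q ^ n) (sym (trans (cong (q *_) (∑ᵛ-zero q n)) (*-zeroʳ q))) z≤n
... | no w≢u  = ≤-reflexive (∑ᵛ-collision w≢u)

collisions : ∀ {q n D} → Vec (Fin q) n → Fin n → Fin n → Vec (Fin n) D → ℕ
collisions {D = D} h u v s =
  ∑[ i < D ] (𝟙 (collides? h (lookup s i) u) + 𝟙 (collides? h (lookup s i) v))

∑ᵛ-collisions : ∀ {q n D} (u v : Fin n) (s : Vec (Fin n) D) →
                q * ∑ᵛ {q} (λ h → collisions h u v s) ≤ D * (q ^ n + q ^ n)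
∑ᵛ-collisions {q} {n} {D} u v s = begin
  q * ∑ᵛ (λ h → ∑[ i < D ] (c h i u + c h i v))
    ≡⟨ cong (q *_) (∑ᵛ-∑-comm λ h i → c h i u + c h i v) ⟩
  q * ∑[ i < D ] ∑ᵛ (λ h → c h i u + c h i v)
    ≡⟨ *-distribˡ-sum q (λ i → ∑ᵛ λ h → c h i u + c h i v) ⟩
  ∑[ i < D ] (q * ∑ᵛ (λ h → c h i u + c h i v))   ≡⟨ sum-cong-≗ {D} (λ i → split i) ⟩
  ∑[ i < D ] (q * ∑ᵛ (λ h → c h i u) + q * ∑ᵛ (λ h → c h i v))
    ≤⟨ ∑-mono-≤ (λ i → +-mono-≤ (∑ᵛ-collides (lookup s i) u) (∑ᵛ-collides (lookup s i) v)) ⟩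
  ∑[ i < D ] (q ^ n + q ^ n)                      ≡⟨ ∑-const D (q ^ n + q ^ n) ⟩
  D * (q ^ n + q ^ n)                             ∎
  where
  open ≤-Reasoning
  c : Vec (Fin q) n → Fin D → Fin n → ℕ
  c h i x = 𝟙 (collides? h (lookup s i) x)
  split : ∀ i → q * ∑ᵛ (λ h → c h i u + c h i v) ≡ q * ∑ᵛ (λ h → c h i u) + q * ∑ᵛ (λ h → c h i v)
  split i = trans (cong (q *_) (∑ᵛ-distrib-+ (λ h → c h i u) (λ h → c h i v))) (*-distribˡ-+ q _ _)

collision-free-majority : ∀ {n D} (u v : Fin n) (s : Vec (Fin n) (suc D)) →
  (4 * suc D) ^ n ≤ 2 * ∑ᵛ (λ h → 𝟙 (collisions h u v s ℕ.≟ 0))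
collision-free-majority {n} {D} u v s = ∑ᵛ-half-zero (λ h → collisions h u v s)
  (quarter (∑ᵛ-collisions u v s))
  where
  quarter : ∀ {X Y} → 4 * suc D * X ≤ suc D * (Y + Y) → 2 * X ≤ Y
  quarter {X} {Y} le = *-cancelˡ-≤ 2 (*-cancelˡ-≤ (suc D) (subst₂ _≤_ (lhs D X) (rhs D Y) le))
    where
    lhs : ∀ d x → 4 * suc d * x ≡ suc d * (2 * (2 * x))
    lhs = solve-∀
    rhs : ∀ d y → suc d * (y + y) ≡ suc d * (2 * y)
    rhs = solve-∀

collision-free-on : ∀ {q n D} (h : Vec (Fin q) n) {u v w : Fin n} {s : Vec (Fin n) D} →
  collisions h u v s ≡ 0 → w ∈ᵛ s → ¬ Collides h w u × ¬ Collides h w v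
collision-free-on h {u} {v} {s = s} none w∈s =
  subst (λ w → ¬ Collides h w u × ¬ Collides h w v) (sym (lookup-index w∈s))
        (𝟙≡0⇒¬ (collides? h (lookup s i) u) (m+n≡0⇒m≡0 _ termᵢ≡0) ,
         𝟙≡0⇒¬ (collides? h (lookup s i) v) (m+n≡0⇒n≡0 _ termᵢ≡0))
  where
  i = Any.index w∈s
  term : Fin _ → ℕ
  term j = 𝟙 (collides? h (lookup s j) u) + 𝟙 (collides? h (lookup s j) v)
  termᵢ≡0 : term i ≡ 0
  termᵢ≡0 = n≤0⇒n≡0 (subst (term i ≤_) none (≤-∑ term i))

module _ {q n p k : ℕ} {c} (Covers : Vec (Fin (suc q)) n → Vec (Fin p) k → Set c)
         (covers? : ∀ h r → Dec (Covers h r))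
         (majority : ∀ r → suc q ^ n ≤ 2 * ∑ᵛ (λ h → 𝟙 (covers? h r))) where

  half-cover : ∀ {ℓ} {P : Vec (Fin p) k → Set ℓ} (P? : ∀ r → Dec (P r)) →
    ∃ λ h → ∑ᵛ (λ r → 𝟙 (P? r)) ≤ 2 * ∑ᵛ (λ r → 𝟙 (P? r ×-dec covers? h r))
  half-cover P? = ∑ᵛ-averaging (λ h → 2 * T h) (begin
    suc q ^ n * ∑ᵛ (λ r → 𝟙 (P? r))             ≡⟨ *-distribˡ-∑ᵛ (suc q ^ n) (λ r → 𝟙 (P? r)) ⟩
    ∑ᵛ (λ r → suc q ^ n * 𝟙 (P? r))             ≤⟨ ∑ᵛ-mono-≤ pointwise ⟩
    ∑ᵛ (λ r → 2 * ∑ᵛ λ h → 𝟙 (P? r ×-dec covers? h r))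
      ≡⟨ *-distribˡ-∑ᵛ 2 (λ r → ∑ᵛ λ h → 𝟙 (P? r ×-dec covers? h r)) ⟨
    2 * ∑ᵛ (λ r → ∑ᵛ λ h → 𝟙 (P? r ×-dec covers? h r))
      ≡⟨ cong (2 *_) (∑ᵛ-comm λ h r → 𝟙 (P? r ×-dec covers? h r)) ⟨
    2 * ∑ᵛ T                                    ≡⟨ *-distribˡ-∑ᵛ 2 T ⟩
    ∑ᵛ (λ h → 2 * T h)                          ∎)
    where
    open ≤-Reasoning
    T : Vec (Fin (suc q)) n → ℕ
    T h = ∑ᵛ λ r → 𝟙 (P? r ×-dec covers? h r)
    pointwise : ∀ r → suc q ^ n * 𝟙 (P? r) ≤ 2 * ∑ᵛ λ h → 𝟙 (P? r ×-dec covers? h r)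
    pointwise r with P? r
    ... | yes _ = ≤-trans (≤-reflexive (*-identityʳ (suc q ^ n))) (majority r)
    ... | no _  = ≤-trans (≤-reflexive (*-zeroʳ (suc q ^ n))) z≤n

  greedy-cover : ∀ L {ℓ} {P : Vec (Fin p) k → Set ℓ} (P? : ∀ r → Dec (P r)) →
    ∑ᵛ (λ r → 𝟙 (P? r)) < 2 ^ L →
    ∃ λ (hs : Vec (Vec (Fin (suc q)) n) L) → ∀ r → P r → ∃ λ i → Covers (lookup hs i) r
  greedy-cover zero P? ∑<1 = [] , λ r Pr →
    contradiction (≤-trans (≤-reflexive (sym (𝟙-yes (P? r) Pr))) (≤-∑ᵛ (λ r → 𝟙 (P? r)) r))
                  (<⇒≱ ∑<1)
  greedy-cover (suc L) {P = P} P? ∑<2ᴸ⁺¹ = h ∷ hs , cover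
    where
    h = proj₁ (half-cover P?)
    Rest? : ∀ r → Dec (P r × ¬ Covers h r)
    Rest? r = P? r ×-dec ¬? (covers? h r)
    R = ∑ᵛ λ r → 𝟙 (P? r)
    C = ∑ᵛ λ r → 𝟙 (P? r ×-dec covers? h r)
    R′ = ∑ᵛ λ r → 𝟙 (Rest? r)
    R≤2C : R ≤ 2 * C
    R≤2C = proj₂ (half-cover P?)
    R≡C+R′ : R ≡ C + R′
    R≡C+R′ = trans (∑ᵛ-cong λ r → 𝟙-split (P? r) (covers? h r))
                   (∑ᵛ-distrib-+ (λ r → 𝟙 (P? r ×-dec covers? h r)) (λ r → 𝟙 (Rest? r)))
    2R′≤R : 2 * R′ ≤ R
    2R′≤R = +-cancelʳ-≤ (2 * C) (2 * R′) R (begin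
      2 * R′ + 2 * C  ≡⟨ *-distribˡ-+ 2 R′ C ⟨
      2 * (R′ + C)    ≡⟨ cong (2 *_) (trans (+-comm R′ C) (sym R≡C+R′)) ⟩
      2 * R           ≡⟨ cong (R +_) (+-identityʳ R) ⟩
      R + R           ≤⟨ +-monoʳ-≤ R R≤2C ⟩
      R + 2 * C       ∎)
      where open ≤-Reasoning
    R′<2ᴸ : R′ < 2 ^ L
    R′<2ᴸ = *-cancelˡ-< 2 R′ (2 ^ L) (≤-<-trans 2R′≤R ∑<2ᴸ⁺¹)
    rest = greedy-cover L Rest? R′<2ᴸ
    hs = proj₁ rest
    cover : ∀ r → P r → ∃ λ i → Covers (lookup (h ∷ hs) i) r
    cover r Pr with covers? h r
    ... | yes hr = zero , hr
    ... | no ¬hr = let i , hsᵢr = proj₂ rest r (Pr , ¬hr) in suc i , hsᵢr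

IsolatedIn : ∀ {n} → Graph n → Subset n → Fin n → Set
IsolatedIn G U x = x ∈ U × (∀ {w} → adj G x w ≡ true → w ∉ U)

isolated∈maximal : ∀ {n} (G : Graph n) {U I x} →
  IsMaximalIndependentIn G U I → IsolatedIn G U x → x ∈ I
isolated∈maximal G {I = I} {x} ((I⊆U , _) , maximal) (x∈U , isolated) with x ∈? I
... | yes x∈I = x∈I
... | no  x∉I = let w , w∈I , w~x = maximal x∈U x∉I in
  contradiction (I⊆U w∈I) (isolated (trans (adj-sym G x w) w~x))

noneContainsBoth? : ∀ {m n} (answers : Fin m → Subset n) u v →
                    Dec (∀ i → ¬ (u ∈ answers i × v ∈ answers i))
noneContainsBoth? answers u v = all? λ i → ¬? (u ∈? answers i ×-dec v ∈? answers i)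

decodeEdges : ∀ {m n} → (Fin m → Subset n) → Fin n → Fin n → Bool
decodeEdges answers u v = does (noneContainsBoth? answers u v)

decodeEdges-correct : ∀ {m n} (G : Graph n) {queries answers : Fin m → Subset n} →
  (∀ i → IsMaximalIndependentIn G (queries i) (answers i)) →
  (∀ {u v} → adj G u v ≡ false → ∃ λ i → IsolatedIn G (queries i) u × IsolatedIn G (queries i) v) →
  ∀ u v → decodeEdges answers u v ≡ adj G u v
decodeEdges-correct G {answers = answers} mis separated u v with adj G u v in u~v
... | true  = dec-true (noneContainsBoth? answers u v) λ i (u∈ , v∈) →
  contradiction (trans (sym u~v) (proj₂ (proj₁ (mis i)) u∈ v∈)) λ ()
... | false = let i , u-isolated , v-isolated = separated u~v in
  dec-false (noneContainsBoth? answers u v) λ none →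
    none i (isolated∈maximal G (mis i) u-isolated , isolated∈maximal G (mis i) v-isolated)

preimage : ∀ {q n} → Vec (Fin q) n → Subset q → Subset n
preimage h S = map (lookup S) h

∈-preimage⁺ : ∀ {q n} (h : Vec (Fin q) n) {S x} → lookup h x ∈ S → x ∈ preimage h S
∈-preimage⁺ h {S} {x} hx∈S =
  lookup⇒[]= x (preimage h S) (trans (lookup-map x (lookup S) h) ([]=⇒lookup hx∈S))

∈-preimage⁻ : ∀ {q n} (h : Vec (Fin q) n) {S x} → x ∈ preimage h S → lookup h x ∈ S
∈-preimage⁻ h {S} {x} x∈h⁻¹S =
  lookup⇒[]= (lookup h x) S (trans (sym (lookup-map x (lookup S) h)) ([]=⇒lookup x∈h⁻¹S))

hashQuery : ∀ {q n} → Vec (Fin q) n → Fin q → Fin q → Subset n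
hashQuery h α β = preimage h (⁅ α ⁆ ∪ ⁅ β ⁆)

hashQueries : ∀ {q n L} → Vec (Vec (Fin q) n) L → Fin (L * (q * q)) → Subset n
hashQueries {q} hs = uncurry (λ ℓ → uncurry (hashQuery (lookup hs ℓ)) ∘ remQuot q) ∘ remQuot (q * q)

hashQueries-combine : ∀ {q n L} (hs : Vec (Vec (Fin q) n) L) ℓ α β →
  hashQueries hs (combine ℓ (combine α β)) ≡ hashQuery (lookup hs ℓ) α β
hashQueries-combine {q} hs ℓ α β =
  trans (cong (uncurry λ ℓ → uncurry (hashQuery (lookup hs ℓ)) ∘ remQuot q)
              (remQuot-combine ℓ (combine α β)))
        (cong (uncurry (hashQuery (lookup hs ℓ))) (remQuot-combine α β))

∉-hashQuery : ∀ {q n} (h : Vec (Fin q) n) {u v w} →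
  ¬ Collides h w u → ¬ Collides h w v → w ≢ u → w ≢ v → w ∉ hashQuery h (lookup h u) (lookup h v)
∉-hashQuery h {u} {v} {w} no-u no-v w≢u w≢v w∈Q
  with x∈p∪q⁻ ⁅ lookup h u ⁆ ⁅ lookup h v ⁆ (∈-preimage⁻ h w∈Q)
... | inj₁ hw∈⁅hu⁆ = no-u (w≢u , x∈⁅y⁆⇒x≡y (lookup h u) hw∈⁅hu⁆)
... | inj₂ hw∈⁅hv⁆ = no-v (w≢v , x∈⁅y⁆⇒x≡y (lookup h v) hw∈⁅hv⁆)

≢-non-neighbour : ∀ {n} (G : Graph n) {x y w} → adj G x w ≡ true → adj G x y ≡ false → w ≢ y
≢-non-neighbour G x~w x≁y refl = contradiction (trans (sym x~w) x≁y) λ ()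

isolated-in-hashQuery : ∀ {q n D} (G : Graph n) (h : Vec (Fin q) n) {u v x} {s : Vec (Fin n) D} →
  collisions h u v s ≡ 0 → adj G x u ≡ false → adj G x v ≡ false →
  (∀ {w} → adj G x w ≡ true → w ∈ᵛ s) → lookup h x ∈ ⁅ lookup h u ⁆ ∪ ⁅ lookup h v ⁆ →
  IsolatedIn G (hashQuery h (lookup h u) (lookup h v)) x
isolated-in-hashQuery G h none x≁u x≁v listed hx∈ = ∈-preimage⁺ h hx∈ , λ x~w →
  let no-u , no-v = collision-free-on h none (listed x~w) in
  ∉-hashQuery h no-u no-v (≢-non-neighbour G x~w x≁u) (≢-non-neighbour G x~w x≁v)

hashQuery-separates : ∀ {q n D} (G : Graph n) (h : Vec (Fin q) n) {u v} {s : Vec (Fin n) D} →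
  adj G u v ≡ false → collisions h u v s ≡ 0 →
  (∀ {w} → adj G u w ≡ true → w ∈ᵛ s) → (∀ {w} → adj G v w ≡ true → w ∈ᵛ s) →
  let Q = hashQuery h (lookup h u) (lookup h v) in IsolatedIn G Q u × IsolatedIn G Q v
hashQuery-separates G h {u} {v} u≁v none u-listed v-listed =
  isolated-in-hashQuery G h none (irrefl G u) u≁v u-listed (x∈p∪q⁺ (inj₁ (x∈⁅x⁆ (lookup h u)))) ,
  isolated-in-hashQuery G h none (trans (adj-sym G v u) u≁v) (irrefl G v) v-listed
                        (x∈p∪q⁺ (inj₂ (x∈⁅x⁆ (lookup h v))))

listing : ∀ {n} (p : Subset n) → ∃ λ (xs : Vec (Fin n) ∣ p ∣) → ∀ {x} → x ∈ p → x ∈ᵛ xs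
listing []            = [] , λ ()
listing (inside ∷ p)  = let xs , p⊆xs = listing p in
  zero ∷ map suc xs , λ { here → Any.here refl ; (there x∈p) → Any.there (∈-map⁺ suc (p⊆xs x∈p)) }
listing (outside ∷ p) = let xs , p⊆xs = listing p in
  map suc xs , λ { (there x∈p) → ∈-map⁺ suc (p⊆xs x∈p) }

∈-padRight⁺ : ∀ {A : Set} {m n} (m≤n : m ≤ n) (a : A) {xs : Vec A m} {x} →
              x ∈ᵛ xs → x ∈ᵛ padRight m≤n a xs
∈-padRight⁺ (s≤s m≤n) a (Any.here x≡y)   = Any.here x≡y
∈-padRight⁺ (s≤s m≤n) a (Any.there x∈xs) = Any.there (∈-padRight⁺ m≤n a x∈xs)

∈-tabulate⁺ : ∀ {n} (f : Fin n → Bool) {x} → f x ≡ true → x ∈ tabulate f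
∈-tabulate⁺ f {x} fx≡true = lookup⇒[]= x (tabulate f) (trans (lookup∘tabulate f x) fx≡true)

neighbours-listed : ∀ {n Δ} (G : Graph n) → MaxDegree≤ G Δ → ∀ u →
  ∃ λ (s : Vec (Fin n) Δ) → ∀ {w} → adj G u w ≡ true → w ∈ᵛ s
neighbours-listed G maxDeg u = let xs , N⊆xs = listing (tabulate (adj G u)) in
  padRight (maxDeg u) u xs , λ u~w → ∈-padRight⁺ (maxDeg u) u (N⊆xs (∈-tabulate⁺ (adj G u) u~w))

Reconstructs : ∀ {m} n Δ → (Fin m → Subset n) → ((Fin m → Subset n) → Fin n → Fin n → Bool) → Set
Reconstructs n Δ queries decode =
  (G : Graph n) → MaxDegree≤ G Δ →
  (answers : _ → Subset n) → (∀ i → IsMaximalIndependentIn G (queries i) (answers i)) →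
  ∀ u v → decode answers u v ≡ adj G u v

edgeless-reconstructs : ∀ {n Δ} → (∀ (G : Graph n) → MaxDegree≤ G Δ → ∀ u v → adj G u v ≡ false) →
  Reconstructs {0} n Δ (λ ()) (λ _ _ _ → false)
edgeless-reconstructs edgeless G maxDeg _ _ u v = sym (edgeless G maxDeg u v)

Separating : ∀ {q n L} → ℕ → Vec (Vec (Fin q) n) L → Set
Separating {n = n} D hs = ∀ u v (s : Vec (Fin n) D) → ∃ λ ℓ → collisions (lookup hs ℓ) u v s ≡ 0

hashQueries-reconstruct : ∀ {q n Δ L} (hs : Vec (Vec (Fin q) n) L) → Separating (Δ + Δ) hs →
  Reconstructs n Δ (hashQueries hs) decodeEdges
hashQueries-reconstruct hs separating G maxDeg answers mis =
  decodeEdges-correct G mis λ {u} {v} u≁v →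
    let su , u-listed = neighbours-listed G maxDeg u
        sv , v-listed = neighbours-listed G maxDeg v
        ℓ , none      = separating u v (su ++ sv)
        h             = lookup hs ℓ
    in combine ℓ (combine (lookup h u) (lookup h v)) ,
       subst (λ Q → IsolatedIn G Q u × IsolatedIn G Q v)
             (sym (hashQueries-combine hs ℓ (lookup h u) (lookup h v)))
             (hashQuery-separates G h u≁v none (∈-++⁺ˡ ∘ u-listed) (∈-++⁺ʳ su ∘ v-listed))

n≤2^⌈log₂n⌉ : ∀ n → n ≤ 2 ^ ⌈log₂ n ⌉
n≤2^⌈log₂n⌉ n = go n (<-wellFounded n)
  where
  go : ∀ n (acc : Acc _<_ n) → n ≤ 2 ^ ⌈log2⌉ n acc
  go zero          _         = z≤n
  go (suc zero)    _         = s≤s z≤n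
  go (suc (suc n)) (acc rec) = double (go (suc ⌈ n /2⌉) (rec (⌈n/2⌉<n n)))
    where
    double : ∀ {X} → suc ⌈ n /2⌉ ≤ X → suc (suc n) ≤ 2 * X
    double {X} half = begin
      suc (suc n)                   ≡⟨ cong (λ x → suc (suc x)) (⌊n/2⌋+⌈n/2⌉≡n n) ⟨
      suc (suc (⌊ n /2⌋ + ⌈ n /2⌉)) ≤⟨ s≤s (s≤s (+-monoˡ-≤ ⌈ n /2⌉ (⌊n/2⌋≤⌈n/2⌉ n))) ⟩
      suc (suc (⌈ n /2⌉ + ⌈ n /2⌉)) ≡⟨ cong suc (+-suc ⌈ n /2⌉ ⌈ n /2⌉) ⟨
      suc ⌈ n /2⌉ + suc ⌈ n /2⌉     ≤⟨ +-mono-≤ half half ⟩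
      X + X                         ≡⟨ cong (X +_) (+-identityʳ X) ⟨
      2 * X                         ∎
      where open ≤-Reasoning

vector-count<2^ : ∀ n K → ∑ᵛ {n} {K} (λ _ → 𝟙 (yes tt)) < 2 ^ suc (K * ⌈log₂ n ⌉)
vector-count<2^ n K = begin-strict
  ∑ᵛ {n} {K} (λ _ → 1)  ≡⟨ trans (∑ᵛ-const n K 1) (*-identityʳ (n ^ K)) ⟩
  n ^ K                 ≤⟨ ^-monoˡ-≤ K (n≤2^⌈log₂n⌉ n) ⟩
  (2 ^ k) ^ K           ≡⟨ trans (^-*-assoc 2 k K) (cong (2 ^_) (*-comm k K)) ⟩
  2 ^ (K * k)           <⟨ m<m+n (2 ^ (K * k)) (m^n>0 2 (K * k)) ⟩
  2 ^ (K * k) + 2 ^ (K * k) ≡⟨ cong (2 ^ (K * k) +_) (+-identityʳ _) ⟨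
  2 ^ suc (K * k)       ∎
  where
  open ≤-Reasoning
  k = ⌈log₂ n ⌉

separating-family : ∀ n D →
  ∃ λ (hs : Vec (Vec (Fin (4 * suc D)) n) (suc ((2 + suc D) * ⌈log₂ n ⌉))) → Separating (suc D) hs
separating-family n D =
  let hs , covered = greedy-cover CollisionFree collisionFree? majority _ (λ _ → yes tt)
                       (vector-count<2^ n (2 + suc D))
  in hs , λ u v s → covered (u ∷ v ∷ s) tt
  where
  CollisionFree : Vec (Fin (4 * suc D)) n → Vec (Fin n) (2 + suc D) → Set
  CollisionFree h (u ∷ v ∷ s) = collisions h u v s ≡ 0
  collisionFree? : ∀ h r → Dec (CollisionFree h r)
  collisionFree? h (u ∷ v ∷ s) = collisions h u v s ℕ.≟ 0
  majority : ∀ r → (4 * suc D) ^ n ≤ 2 * ∑ᵛ (λ h → 𝟙 (collisionFree? h r))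
  majority (u ∷ v ∷ s) = collision-free-majority u v s

ReconstructionWithin : ℕ → ℕ → ℕ → Set
ReconstructionWithin budget n Δ =
  Σ ℕ λ m → Σ (Fin m → Subset n) λ queries →
  Σ ((Fin m → Subset n) → Fin n → Fin n → Bool) λ decode →
    m ≤ budget × Reconstructs n Δ queries decode

edgeless-reconstruction : ∀ {budget n Δ} →
  (∀ (G : Graph n) → MaxDegree≤ G Δ → ∀ u v → adj G u v ≡ false) → ReconstructionWithin budget n Δ
edgeless-reconstruction edgeless =
  0 , (λ ()) , (λ _ _ _ → false) , z≤n , edgeless-reconstructs edgeless

degree-zero-edgeless : ∀ {n} (G : Graph n) → MaxDegree≤ G 0 → ∀ u v → adj G u v ≡ false
degree-zero-edgeless G maxDeg u v with adj G u v in u~v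
... | true  = case proj₂ (neighbours-listed G maxDeg u) u~v of λ ()
... | false = refl

hash-query-count : ∀ Δ k → 1 ≤ Δ → 1 ≤ k →
  suc ((2 + (Δ + Δ)) * k) * (4 * (Δ + Δ) * (4 * (Δ + Δ))) ≤ 320 * (Δ ^ 3 * k)
hash-query-count (suc d) (suc k) _ _ =
  ≤-trans (m≤m+n _ _) (≤-reflexive (sym (slack d k)))
  where
  slack : ∀ d k → 320 * (suc d * (suc d * (suc d * 1)) * suc k) ≡
    suc ((2 + (suc d + suc d)) * suc k) * (4 * (suc d + suc d) * (4 * (suc d + suc d)))
    + 64 * (suc d * suc d) * (3 * d * k + 3 * d + k)
  slack = solve-∀

corollary5 : Σ ℕ λ C → (n Δ : ℕ) →
  Σ ℕ λ m →
  Σ (Fin m → Subset n) λ queries →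
  Σ ((Fin m → Subset n) → Fin n → Fin n → Bool) λ decode →
    (m ≤ C * (Δ ^ 3 * ⌈log₂ n ⌉)) ×
    ((G : Graph n) → MaxDegree≤ G Δ →
     (answers : Fin m → Subset n) →
     (∀ i → IsMaximalIndependentIn G (queries i) (answers i)) →
     ∀ u v → decode answers u v ≡ adj G u v)
corollary5 = 320 , scheme
  where
  scheme : ∀ n Δ → ReconstructionWithin (320 * (Δ ^ 3 * ⌈log₂ n ⌉)) n Δ
  scheme n             zero    = edgeless-reconstruction degree-zero-edgeless
  scheme zero          (suc d) = edgeless-reconstruction λ _ _ ()
  scheme (suc zero)    (suc d) = edgeless-reconstruction λ { G _ zero zero → irrefl G zero }
  scheme (suc (suc n)) (suc d) =
    let hs , separating = separating-family (2 + n) (d + suc d) in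
    _ , hashQueries hs , decodeEdges ,
    hash-query-count (suc d) ⌈log₂ (2 + n) ⌉ (s≤s z≤n) (s≤s z≤n) ,
    hashQueries-reconstruct hs separating
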